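{- Let $s\ge 2$, $n\ge 2$, and let $A$ be an assignment. Then the 2-opt neighborhood of $A$ has size $|N_{2\text{ -opt}}(A)|=1+\binom{n}{2}\,(2^{s-1}-1)$.
   Context: Let $X=\{1,\dots,n\}^s$; $e_j$ is the $j$-th coordinate of $e\in X$. An assignment is a set of $n$ vectors $A^1,\dots,A^n\in X$ with $A^i_j\ne A^k_j$ for all $i\ne k$ and all $j$; assignments are compared as sets of vectors. For an assignment $A$ and a set $E=\{e^1,\dots,e^k\}\subseteq A$ of $k$ distinct vectors, let $W(A,E)$ be the set of all assignments of the form $(A\setminus E)\cup\{(e^i_1,e^{\sigma_2(i)}_2,\dots,e^{\sigma_s(i)}_s): i=1,\dots,k\}$ where $\sigma_2,\dots,\sigma_s$ are arbitrary permutations of $\{1,\dots,k\}$ (i.e. the coordinates in dimensions $2,\dots,s$ are permuted among the vectors of $E$). The $k$-opt neighborhood is $N_{k\text{ -opt}}(A)=\bigcup_{E\subseteq A,\ |E|=k}W(A,E)$. -}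

module Defs where

open import Data.Nat using (ℕ)
open import Data.Fin using (Fin; zero; suc)
open import Data.Vec using (Vec; lookup; tabulate)
open import Data.Fin.Permutation using (Permutation′; _⟨$⟩ʳ_)
open import Data.Product using (Σ; ∃; _×_; _,_)
open import Data.Sum using (_⊎_)
open import Relation.Binary.PropositionalEquality using (_≡_; _≢_)
open import Function.Definitions using (Injective)

-- X = {1..n}^s, realised as Vec (Fin n) s (values 0..n-1, coordinates 0..s-1;
-- coordinate index zero is the paper's first coordinate e_1).
X : ℕ → ℕ → Set
X n s = Vec (Fin n) s

-- An assignment: n vectors A^1..A^n with pairwise distinct j-th coordinates
-- for every j.  It is compared as a SET of vectors (see _≈A_).
record Assignment (n s : ℕ) : Set where
  field
    vec      : Fin n → X n s
    distinct : ∀ i k → i ≢ k → ∀ j → lookup (vec i) j ≢ lookup (vec k) j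
open Assignment public

_∈A_ : ∀ {n s} → X n s → Assignment n s → Set
x ∈A A = ∃ λ i → vec A i ≡ x

_≈A_ : ∀ {n s} → Assignment n s → Assignment n s → Set
A ≈A B = ∀ x → ((x ∈A A → x ∈A B) × (x ∈A B → x ∈A A))

coordPerm : ∀ {s k} → (Fin s → Permutation′ k) → Fin s → Fin k → Fin k
coordPerm σ zero    t = t
coordPerm σ (suc j) t = σ (suc j) ⟨$⟩ʳ t

-- E = {A^{ι t} : t} is a k-element subset of A (ι injective).
-- The new vectors (e^t_1, e^{σ_2(t)}_2, ..., e^{σ_s(t)}_s):
newVec : ∀ {n s k} → Assignment n s → (ι : Fin k → Fin n) →
         (Fin s → Permutation′ k) → Fin k → X n s
newVec A ι σ t = tabulate (λ j → lookup (vec A (ι (coordPerm σ j t))) j)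

-- C ∈ W(A,E) with E = ι-image: C equals, as a set,
-- (A \ E) ∪ { newVec t : t }
InW : ∀ {n s k} → Assignment n s → (ι : Fin k → Fin n) → Assignment n s → Set
InW {n} {s} {k} A ι C = Σ (Fin s → Permutation′ k) λ σ →
  ∀ x → ((x ∈A C) → ((∃ λ i → ((∀ t → ι t ≢ i) × vec A i ≡ x)) ⊎ (∃ λ t → newVec A ι σ t ≡ x)))
      × (((∃ λ i → ((∀ t → ι t ≢ i) × vec A i ≡ x)) ⊎ (∃ λ t → newVec A ι σ t ≡ x)) → (x ∈A C))

-- k-opt neighbourhood: union over all k-element subsets E of A
InKOpt : ∀ {n s} → (k : ℕ) → Assignment n s → Assignment n s → Set
InKOpt {n} k A C = Σ (Fin k → Fin n) λ ι → Injective _≡_ _≡_ ι × InW A ι C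

HasSize : ∀ {n s} → (Assignment n s → Set) → ℕ → Set
HasSize {n} {s} N m = Σ (Fin m → Assignment n s) λ f →
    (∀ i → N (f i))
  × (∀ i j → f i ≈A f j → i ≡ j)
  × (∀ C → N C → ∃ λ i → C ≈A f i)

module Submission where

-- A 2-opt move on two distinct rows a, b of A keeps the first coordinates and, in each of the
-- other s − 1 dimensions, either exchanges the entries of rows a and b or leaves them; it is
-- therefore described by the pair {a, b} and a swap pattern S ∈ {0,1}^(s−1).  The zero pattern
-- returns A itself, whatever the pair.  Since the first coordinates are distinct and fixed, two
-- neighbours are equal as sets only if they are equal row by row; a nonzero pattern changes
-- exactly the rows a and b, which recovers the pair, and row a then recovers S.  So the
-- neighbourhood is in bijection with {A} ⊎ (pairs × nonzero patterns).

open import Defs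
open import Data.Nat using (ℕ; zero; suc; _≤_; _<_; _+_; _*_; _∸_; _^_; s≤s; z≤n)
open import Data.Nat.Properties using (<-irrefl; <-asym; +-identityʳ; +-∸-assoc; m^n>0)
open import Data.Nat.Combinatorics using (_C_; nC1≡n; nCk+nC[k+1]≡[n+1]C[k+1])
open import Data.Bool using (Bool; true; false)
open import Data.Unit using (⊤; tt)
open import Data.Fin using (Fin; zero; suc; toℕ; _≟_)
open import Data.Fin.Patterns using (0F; 1F)
open import Data.Fin.Properties using (suc-injective; 1↔⊤; 2↔Bool; +↔⊎; *↔×)
open import Data.Fin.Permutation using (Permutation′; _⟨$⟩ʳ_)
import Data.Fin.Permutation as Perm
open import Data.Fin.Permutation.Components using (transpose)
open import Data.Vec using (Vec; []; _∷_; lookup; tabulate; replicate)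
open import Data.Vec.Properties
  using (lookup∘tabulate; tabulate∘lookup; tabulate-cong; lookup-replicate; ∷-injective)
open import Data.Vec.Relation.Binary.Pointwise.Extensional using (ext; Pointwise-≡⇒≡)
open import Data.Sum using (_⊎_; inj₁; inj₂)
open import Data.Product using (Σ; ∃; _×_; _,_; proj₁; proj₂)
open import Data.Sum.Function.Propositional using (_⊎-↔_)
open import Data.Product.Function.NonDependent.Propositional using (_×-↔_)
open import Function using (id; _∘_)
open import Function.Bundles using (_↔_; Inverse; Injection; mk↔ₛ′)
open import Function.Definitions using (Injective)
open import Function.Properties.Inverse using (↔-refl; ↔-sym; ↔⇒↣)
open import Function.Related.Propositional using (module EquationalReasoning)
open import Relation.Binary.PropositionalEquality
open import Relation.Nullary using (yes; no; contradiction)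

private
  variable
    k m n s : ℕ

-- Counting

-- Pairs i < j in Fin n: first j is (0, 1 + j) and later p is p shifted up by one.
data Pair : ℕ → Set where
  first : Fin n → Pair (suc n)
  later : Pair n → Pair (suc n)

lo hi : Pair n → Fin n
lo (first j) = zero
lo (later p) = suc (lo p)
hi (first j) = suc j
hi (later p) = suc (hi p)

lo<hi : (p : Pair n) → toℕ (lo p) < toℕ (hi p)
lo<hi (first j) = s≤s z≤n
lo<hi (later p) = s≤s (lo<hi p)

lo≢hi : (p : Pair n) → lo p ≢ hi p
lo≢hi p lo≡hi = <-irrefl (cong toℕ lo≡hi) (lo<hi p)

Pair-≡ : {p q : Pair n} → lo p ≡ lo q → hi p ≡ hi q → p ≡ q
Pair-≡ {p = first j} {first .j} refl refl = refl
Pair-≡ {p = first j} {later q}  ()   _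
Pair-≡ {p = later p} {first j}  ()   _
Pair-≡ {p = later p} {later q}  lo≡ hi≡ = cong later (Pair-≡ (suc-injective lo≡) (suc-injective hi≡))

Pair-≡-endpoints : (p q : Pair n) → lo p ≡ lo q ⊎ lo p ≡ hi q → hi p ≡ lo q ⊎ hi p ≡ hi q → p ≡ q
Pair-≡-endpoints p q (inj₁ l≡l) (inj₁ h≡l) = contradiction (trans l≡l (sym h≡l)) (lo≢hi p)
Pair-≡-endpoints p q (inj₁ l≡l) (inj₂ h≡h) = Pair-≡ l≡l h≡h
Pair-≡-endpoints p q (inj₂ l≡h) (inj₁ h≡l) =
  contradiction (subst₂ (λ u v → toℕ u < toℕ v) l≡h h≡l (lo<hi p)) (<-asym (lo<hi q))
Pair-≡-endpoints p q (inj₂ l≡h) (inj₂ h≡h) = contradiction (trans l≡h (sym h≡h)) (lo≢hi p)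

toPair : (a b : Fin n) → a ≢ b → Σ (Pair n) λ p → (lo p ≡ a × hi p ≡ b) ⊎ (lo p ≡ b × hi p ≡ a)
toPair zero    zero    a≢b = contradiction refl a≢b
toPair zero    (suc j) _   = first j , inj₁ (refl , refl)
toPair (suc i) zero    _   = first i , inj₂ (refl , refl)
toPair (suc i) (suc j) a≢b with toPair i j (a≢b ∘ cong suc)
... | p , inj₁ (l≡ , h≡) = later p , inj₁ (cong suc l≡ , cong suc h≡)
... | p , inj₂ (l≡ , h≡) = later p , inj₂ (cong suc l≡ , cong suc h≡)

Pair-suc↔ : ∀ n → Pair (suc n) ↔ (Fin n ⊎ Pair n)
Pair-suc↔ n = mk↔ₛ′
  (λ { (first j) → inj₁ j ; (later p) → inj₂ p })
  (λ { (inj₁ j) → first j ; (inj₂ p) → later p })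
  (λ { (inj₁ _) → refl ; (inj₂ _) → refl })
  (λ { (first _) → refl ; (later _) → refl })

suc-C-2 : ∀ n → n + n C 2 ≡ suc n C 2
suc-C-2 n = trans (cong (_+ n C 2) (sym (nC1≡n n))) (nCk+nC[k+1]≡[n+1]C[k+1] n 1)

Pair↔ : ∀ n → Pair n ↔ Fin (n C 2)
Pair↔ zero    = mk↔ₛ′ (λ ()) (λ ()) (λ ()) (λ ())
Pair↔ (suc n) = begin
  Pair (suc n)          ↔⟨ Pair-suc↔ n ⟩
  (Fin n ⊎ Pair n)      ↔⟨ ↔-refl ⊎-↔ Pair↔ n ⟩
  (Fin n ⊎ Fin (n C 2)) ↔⟨ +↔⊎ ⟨
  Fin (n + n C 2)       ≡⟨ cong Fin (suc-C-2 n) ⟩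
  Fin (suc n C 2)       ∎
  where open EquationalReasoning

Vec-suc↔ : {A : Set} → ∀ m → Vec A (suc m) ↔ (A × Vec A m)
Vec-suc↔ m = mk↔ₛ′ (λ { (x ∷ xs) → x , xs }) (λ { (x , xs) → x ∷ xs }) (λ _ → refl) (λ { (_ ∷ _) → refl })

Vec-Bool↔ : ∀ m → Vec Bool m ↔ Fin (2 ^ m)
Vec-Bool↔ zero    = mk↔ₛ′ (λ _ → zero) (λ _ → []) (λ { zero → refl ; (suc ()) }) (λ { [] → refl })
Vec-Bool↔ (suc m) = begin
  Vec Bool (suc m)      ↔⟨ Vec-suc↔ m ⟩
  (Bool × Vec Bool m)   ↔⟨ ↔-sym 2↔Bool ×-↔ Vec-Bool↔ m ⟩
  (Fin 2 × Fin (2 ^ m)) ↔⟨ *↔× ⟨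
  Fin (2 ^ suc m)       ∎
  where open EquationalReasoning

data Nonzero : ℕ → Set where
  here  : Vec Bool m → Nonzero (suc m)
  there : Nonzero m → Nonzero (suc m)

bits : Nonzero m → Vec Bool m
bits (here v)  = true ∷ v
bits (there e) = false ∷ bits e

bits-injective : {e e′ : Nonzero m} → bits e ≡ bits e′ → e ≡ e′
bits-injective {e = here v}  {here v′}  eq = cong here (proj₂ (∷-injective eq))
bits-injective {e = here v}  {there e′} eq with ∷-injective eq
... | () , _
bits-injective {e = there e} {here v′}  eq with ∷-injective eq
... | () , _
bits-injective {e = there e} {there e′} eq = cong there (bits-injective (proj₂ (∷-injective eq)))

bits-has-true : (e : Nonzero m) → ∃ λ j → lookup (bits e) j ≡ true
bits-has-true (here v)  = zero , refl
bits-has-true (there e) with bits-has-true e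
... | j , bitⱼ = suc j , bitⱼ

zero-or-nonzero : (v : Vec Bool m) → v ≡ replicate m false ⊎ ∃ λ e → bits e ≡ v
zero-or-nonzero []          = inj₁ refl
zero-or-nonzero (true ∷ v)  = inj₂ (here v , refl)
zero-or-nonzero (false ∷ v) with zero-or-nonzero v
... | inj₁ v≡0       = inj₁ (cong (false ∷_) v≡0)
... | inj₂ (e , e≡v) = inj₂ (there e , cong (false ∷_) e≡v)

Nonzero-suc↔ : ∀ m → Nonzero (suc m) ↔ (Vec Bool m ⊎ Nonzero m)
Nonzero-suc↔ m = mk↔ₛ′
  (λ { (here v) → inj₁ v ; (there e) → inj₂ e })
  (λ { (inj₁ v) → here v ; (inj₂ e) → there e })
  (λ { (inj₁ _) → refl ; (inj₂ _) → refl })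
  (λ { (here _) → refl ; (there _) → refl })

2^suc∸1 : ∀ m → 2 ^ m + (2 ^ m ∸ 1) ≡ 2 ^ suc m ∸ 1
2^suc∸1 m = begin
  2 ^ m + (2 ^ m ∸ 1)   ≡⟨ +-∸-assoc (2 ^ m) (m^n>0 2 m) ⟨
  2 ^ m + 2 ^ m ∸ 1     ≡⟨ cong (λ x → 2 ^ m + x ∸ 1) (+-identityʳ (2 ^ m)) ⟨
  2 ^ suc m ∸ 1         ∎
  where open ≡-Reasoning

Nonzero↔ : ∀ m → Nonzero m ↔ Fin (2 ^ m ∸ 1)
Nonzero↔ zero    = mk↔ₛ′ (λ ()) (λ ()) (λ ()) (λ ())
Nonzero↔ (suc m) = begin
  Nonzero (suc m)                 ↔⟨ Nonzero-suc↔ m ⟩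
  (Vec Bool m ⊎ Nonzero m)        ↔⟨ Vec-Bool↔ m ⊎-↔ Nonzero↔ m ⟩
  (Fin (2 ^ m) ⊎ Fin (2 ^ m ∸ 1)) ↔⟨ +↔⊎ ⟨
  Fin (2 ^ m + (2 ^ m ∸ 1))       ≡⟨ cong Fin (2^suc∸1 m) ⟩
  Fin (2 ^ suc m ∸ 1)             ∎
  where open EquationalReasoning

-- Codes of the 2-opt neighbours: inj₁ tt stands for A itself, inj₂ (p , e) for the exchange
-- along the pair p with the nonzero swap pattern e.
Code : ℕ → ℕ → Set
Code n m = ⊤ ⊎ (Pair n × Nonzero m)

Code↔ : ∀ n m → Fin (1 + (n C 2) * (2 ^ m ∸ 1)) ↔ Code n m
Code↔ n m = begin
  Fin (1 + (n C 2) * (2 ^ m ∸ 1))        ↔⟨ +↔⊎ ⟩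
  (Fin 1 ⊎ Fin ((n C 2) * (2 ^ m ∸ 1)))  ↔⟨ 1↔⊤ ⊎-↔ *↔× ⟩
  (⊤ ⊎ (Fin (n C 2) × Fin (2 ^ m ∸ 1)))  ↔⟨ ↔-refl ⊎-↔ (Pair↔ n ×-↔ Nonzero↔ m) ⟨
  Code n m                               ∎
  where open EquationalReasoning

HasSize-↔ : {N : Assignment n s → Set} {I : Set} → Fin k ↔ I → (f : I → Assignment n s) →
  (∀ i → N (f i)) → (∀ i j → f i ≈A f j → i ≡ j) → (∀ B → N B → ∃ λ i → B ≈A f i) → HasSize N k
HasSize-↔ e f f∈N f-injective f-covers =
    f ∘ to
  , f∈N ∘ to
  , (λ i j fi≈fj → Injection.injective (↔⇒↣ e) (f-injective (to i) (to j) fi≈fj))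
  , λ B B∈N → let (i , B≈fi) = f-covers B B∈N in
      from i , subst (λ j → B ≈A f j) (sym (Inverse.strictlyInverseˡ e i)) B≈fi
  where open Inverse e using (to; from)

-- Transpositions

transpose-matchˡ : (i j : Fin n) → transpose i j i ≡ j
transpose-matchˡ i j with i ≟ i
... | yes _   = refl
... | no i≢i = contradiction refl i≢i

transpose-matchʳ : (i j : Fin n) → transpose i j j ≡ i
transpose-matchʳ i j with j ≟ i
... | yes j≡i = j≡i
... | no _ with j ≟ j
...   | yes _   = refl
...   | no j≢j = contradiction refl j≢j

transpose-other : {i j k : Fin n} → k ≢ i → k ≢ j → transpose i j k ≡ k
transpose-other {i = i} {j} {k} k≢i k≢j with k ≟ i
... | yes k≡i = contradiction k≡i k≢i
... | no _ with k ≟ j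
...   | yes k≡j = contradiction k≡j k≢j
...   | no _    = refl

transpose-comm : (i j k : Fin n) → transpose i j k ≡ transpose j i k
transpose-comm i j k with i ≟ k | j ≟ k
... | yes refl | _        = trans (transpose-matchˡ i j) (sym (transpose-matchʳ j i))
... | no _     | yes refl = trans (transpose-matchʳ i j) (sym (transpose-matchˡ j i))
... | no i≢k   | no j≢k   = trans (transpose-other (i≢k ∘ sym) (j≢k ∘ sym))
                             (sym (transpose-other (j≢k ∘ sym) (i≢k ∘ sym)))

transpose-involutive : (i j k : Fin n) → transpose i j (transpose i j k) ≡ k
transpose-involutive i j k with i ≟ k | j ≟ k
... | yes refl | _        = trans (cong (transpose i j) (transpose-matchˡ i j)) (transpose-matchʳ i j)
... | no _     | yes refl = trans (cong (transpose i j) (transpose-matchʳ i j)) (transpose-matchˡ i j)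
... | no i≢k   | no j≢k   = trans (cong (transpose i j) k-fixed) k-fixed
  where k-fixed = transpose-other (i≢k ∘ sym) (j≢k ∘ sym)

transpose-map : {f : Fin n → Fin m} → Injective _≡_ _≡_ f →
  (i j k : Fin n) → f (transpose i j k) ≡ transpose (f i) (f j) (f k)
transpose-map {f = f} f-injective i j k with i ≟ k | j ≟ k
... | yes refl | _        = trans (cong f (transpose-matchˡ i j)) (sym (transpose-matchˡ (f i) (f j)))
... | no _     | yes refl = trans (cong f (transpose-matchʳ i j)) (sym (transpose-matchʳ (f i) (f j)))
... | no i≢k   | no j≢k   = trans (cong f (transpose-other (i≢k ∘ sym) (j≢k ∘ sym)))
                             (sym (transpose-other (i≢k ∘ sym ∘ f-injective) (j≢k ∘ sym ∘ f-injective)))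

swapIf : Bool → Fin n → Fin n → Fin n → Fin n
swapIf false a b k = k
swapIf true  a b k = transpose a b k

swapIf-involutive : ∀ c (a b k : Fin n) → swapIf c a b (swapIf c a b k) ≡ k
swapIf-involutive false a b k = refl
swapIf-involutive true  a b k = transpose-involutive a b k

swapIf-injective : ∀ c (a b : Fin n) → Injective _≡_ _≡_ (swapIf c a b)
swapIf-injective c a b {k} {l} eq = begin
  k                                 ≡⟨ swapIf-involutive c a b k ⟨
  swapIf c a b (swapIf c a b k)     ≡⟨ cong (swapIf c a b) eq ⟩
  swapIf c a b (swapIf c a b l)     ≡⟨ swapIf-involutive c a b l ⟩
  l                                 ∎
  where open ≡-Reasoning

swapIf-other : ∀ c {a b k : Fin n} → k ≢ a → k ≢ b → swapIf c a b k ≡ k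
swapIf-other false k≢a k≢b = refl
swapIf-other true  k≢a k≢b = transpose-other k≢a k≢b

swapIf-comm : ∀ c (a b k : Fin n) → swapIf c a b k ≡ swapIf c b a k
swapIf-comm false a b k = refl
swapIf-comm true  a b k = transpose-comm a b k

swapIf-map : {f : Fin n → Fin m} → Injective _≡_ _≡_ f →
  ∀ c (a b k : Fin n) → f (swapIf c a b k) ≡ swapIf c (f a) (f b) (f k)
swapIf-map f-injective false a b k = refl
swapIf-map f-injective true  a b k = transpose-map f-injective a b k

swapIf-bit-injective : {a b : Fin n} → a ≢ b → ∀ c c′ → swapIf c a b a ≡ swapIf c′ a b a → c ≡ c′
swapIf-bit-injective         a≢b false false eq = refl
swapIf-bit-injective {a = a} a≢b false true  eq = contradiction (trans eq (transpose-matchˡ a _)) a≢b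
swapIf-bit-injective {a = a} a≢b true  false eq = contradiction (trans (sym eq) (transpose-matchˡ a _)) a≢b
swapIf-bit-injective         a≢b true  true  eq = refl

-- Assignments

column-injective : (A : Assignment n s) (j : Fin s) {y y′ : Fin n} →
  lookup (vec A y) j ≡ lookup (vec A y′) j → y ≡ y′
column-injective A j {y} {y′} eq with y ≟ y′
... | yes y≡y′ = y≡y′
... | no  y≢y′ = contradiction eq (distinct A y y′ y≢y′ j)

≗⇒≈A : {B D : Assignment n s} → (∀ y → vec B y ≡ vec D y) → B ≈A D
≗⇒≈A B≗D x = (λ (i , Bi≡x) → i , trans (sym (B≗D i)) Bi≡x) , (λ (i , Di≡x) → i , trans (B≗D i) Di≡x)

≈A-refl : {B : Assignment n s} → B ≈A B
≈A-refl x = id , id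

≈A-trans : {B D E : Assignment n s} → B ≈A D → D ≈A E → B ≈A E
≈A-trans B≈D D≈E x = proj₁ (D≈E x) ∘ proj₁ (B≈D x) , proj₂ (B≈D x) ∘ proj₂ (D≈E x)

≈A⇒≗ : {B D : Assignment n s} (j : Fin s) → (∀ y → lookup (vec B y) j ≡ lookup (vec D y) j) →
  B ≈A D → ∀ y → vec B y ≡ vec D y
≈A⇒≗ {B = B} {D} j same-column B≈D y with proj₁ (B≈D (vec B y)) (y , refl)
... | y′ , Dy′≡By = trans (sym Dy′≡By) (cong (vec D) (column-injective D j (begin
  lookup (vec D y′) j  ≡⟨ cong (λ v → lookup v j) Dy′≡By ⟩
  lookup (vec B y) j   ≡⟨ same-column y ⟩
  lookup (vec D y) j   ∎)))
  where open ≡-Reasoning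

permuteColumns : (A : Assignment n s) (τ : Fin s → Fin n → Fin n) →
  (∀ j → Injective _≡_ _≡_ (τ j)) → Assignment n s
permuteColumns {n} {s} A τ τ-injective = record { vec = row ; distinct = row-distinct }
  where
  row : Fin n → X n s
  row y = tabulate λ j → lookup (vec A (τ j y)) j

  row-distinct : ∀ y y′ → y ≢ y′ → ∀ j → lookup (row y) j ≢ lookup (row y′) j
  row-distinct y y′ y≢y′ j eq = distinct A (τ j y) (τ j y′) (y≢y′ ∘ τ-injective j) j (begin
    lookup (vec A (τ j y)) j   ≡⟨ lookup∘tabulate (λ j → lookup (vec A (τ j y)) j) j ⟨
    lookup (row y) j           ≡⟨ eq ⟩
    lookup (row y′) j          ≡⟨ lookup∘tabulate (λ j → lookup (vec A (τ j y′)) j) j ⟩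
    lookup (vec A (τ j y′)) j  ∎)
    where open ≡-Reasoning

module _ (A : Assignment n s) (τ : Fin s → Fin n → Fin n)
         (τ-injective : ∀ j → Injective _≡_ _≡_ (τ j)) where

  permuteColumns-lookup : ∀ y j →
    lookup (vec (permuteColumns A τ τ-injective) y) j ≡ lookup (vec A (τ j y)) j
  permuteColumns-lookup y = lookup∘tabulate (λ j → lookup (vec A (τ j y)) j)

  permuteColumns-fixed : ∀ y → (∀ j → τ j y ≡ y) → vec (permuteColumns A τ τ-injective) y ≡ vec A y
  permuteColumns-fixed y y-fixed =
    trans (tabulate-cong (λ j → cong (λ z → lookup (vec A z) j) (y-fixed j))) (tabulate∘lookup (vec A y))

-- S is the swap pattern of the dimensions 2..s; the first dimension is never permuted.
swapColumns : Fin n → Fin n → Vec Bool m → Fin (suc m) → Fin n → Fin n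
swapColumns a b S j = swapIf (lookup (false ∷ S) j) a b

swapColumns-injective : ∀ (a b : Fin n) (S : Vec Bool m) j → Injective _≡_ _≡_ (swapColumns a b S j)
swapColumns-injective a b S j = swapIf-injective (lookup (false ∷ S) j) a b

exchange : Assignment n (suc m) → Fin n → Fin n → Vec Bool m → Assignment n (suc m)
exchange A a b S = permuteColumns A (swapColumns a b S) (swapColumns-injective a b S)

module _ (A : Assignment n (suc m)) where

  exchange-lookup : ∀ a b S y j →
    lookup (vec (exchange A a b S) y) j ≡ lookup (vec A (swapColumns a b S j y)) j
  exchange-lookup a b S = permuteColumns-lookup A (swapColumns a b S) (swapColumns-injective a b S)

  exchange-other : ∀ {a b} S {y} → y ≢ a → y ≢ b → vec (exchange A a b S) y ≡ vec A y
  exchange-other {a} {b} S {y} y≢a y≢b =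
    permuteColumns-fixed A (swapColumns a b S) (swapColumns-injective a b S) y
      (λ j → swapIf-other (lookup (false ∷ S) j) y≢a y≢b)

  exchange-zero : ∀ a b y → vec (exchange A a b (replicate m false)) y ≡ vec A y
  exchange-zero a b y =
    permuteColumns-fixed A (swapColumns a b zeros) (swapColumns-injective a b zeros) y λ where
      zero    → refl
      (suc j) → cong (λ c → swapIf c a b y) (lookup-replicate j false)
    where zeros = replicate m false

  exchange-comm : ∀ a b S y → vec (exchange A a b S) y ≡ vec (exchange A b a S) y
  exchange-comm a b S y =
    tabulate-cong λ j → cong (λ z → lookup (vec A z) j) (swapIf-comm (lookup (false ∷ S) j) a b y)

  exchange-moved : ∀ a b S y → vec (exchange A a b S) y ≢ vec A y → y ≡ a ⊎ y ≡ b
  exchange-moved a b S y moved with y ≟ a | y ≟ b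
  ... | yes y≡a | _       = inj₁ y≡a
  ... | no _    | yes y≡b = inj₂ y≡b
  ... | no y≢a  | no y≢b  = contradiction (exchange-other S y≢a y≢b) moved

  exchange-movesˡ : ∀ {a b} → a ≢ b → (e : Nonzero m) → vec (exchange A a b (bits e)) a ≢ vec A a
  exchange-movesˡ {a} {b} a≢b e row≡ with bits-has-true e
  ... | j , bitⱼ = a≢b (column-injective A (suc j) (sym (begin
    lookup (vec A b) (suc j)                                  ≡⟨ cong (λ z → lookup (vec A z) (suc j)) a↦b ⟨
    lookup (vec A (swapIf (lookup (bits e) j) a b a)) (suc j) ≡⟨ exchange-lookup a b (bits e) a (suc j) ⟨
    lookup (vec (exchange A a b (bits e)) a) (suc j)          ≡⟨ cong (λ v → lookup v (suc j)) row≡ ⟩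
    lookup (vec A a) (suc j)                                  ∎)))
    where
    open ≡-Reasoning
    a↦b : swapIf (lookup (bits e) j) a b a ≡ b
    a↦b = trans (cong (λ c → swapIf c a b a) bitⱼ) (transpose-matchˡ a b)

  exchange-movesʳ : ∀ {a b} → a ≢ b → (e : Nonzero m) → vec (exchange A a b (bits e)) b ≢ vec A b
  exchange-movesʳ {a} {b} a≢b e row≡ =
    exchange-movesˡ (a≢b ∘ sym) e (trans (sym (exchange-comm a b (bits e) b)) row≡)

  exchange-pattern-injective : ∀ {a b} → a ≢ b → ∀ S S′ →
    vec (exchange A a b S) a ≡ vec (exchange A a b S′) a → S ≡ S′
  exchange-pattern-injective {a} {b} a≢b S S′ row≡ = Pointwise-≡⇒≡ (ext λ j →
    swapIf-bit-injective a≢b _ _ (column-injective A (suc j) (begin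
      lookup (vec A (swapIf (lookup S j) a b a)) (suc j)  ≡⟨ exchange-lookup a b S a (suc j) ⟨
      lookup (vec (exchange A a b S) a) (suc j)           ≡⟨ cong (λ v → lookup v (suc j)) row≡ ⟩
      lookup (vec (exchange A a b S′) a) (suc j)          ≡⟨ exchange-lookup a b S′ a (suc j) ⟩
      lookup (vec A (swapIf (lookup S′ j) a b a)) (suc j) ∎)))
    where open ≡-Reasoning

  exchange-injective : ∀ p q (e e′ : Nonzero m) →
    (∀ y → vec (exchange A (lo p) (hi p) (bits e)) y ≡ vec (exchange A (lo q) (hi q) (bits e′)) y) →
    (p , e) ≡ (q , e′)
  exchange-injective p q e e′ same
    with Pair-≡-endpoints p q (endpoint (lo p) (exchange-movesˡ (lo≢hi p) e))
                              (endpoint (hi p) (exchange-movesʳ (lo≢hi p) e))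
    where
    endpoint : ∀ y → vec (exchange A (lo p) (hi p) (bits e)) y ≢ vec A y → y ≡ lo q ⊎ y ≡ hi q
    endpoint y moved = exchange-moved (lo q) (hi q) (bits e′) y (moved ∘ trans (same y))
  ... | refl =
    cong (p ,_) (bits-injective (exchange-pattern-injective (lo≢hi p) (bits e) (bits e′) (same (lo p))))

-- The 2-opt neighbourhood

isSwap : Permutation′ 2 → Bool
isSwap π = Inverse.to 2↔Bool (π ⟨$⟩ʳ 0F)

permutation₂ : (π : Permutation′ 2) (t : Fin 2) → π ⟨$⟩ʳ t ≡ swapIf (isSwap π) 0F 1F t
permutation₂ π t = at t (π ⟨$⟩ʳ 0F) refl
  where
  π-injective : Injective _≡_ _≡_ (π ⟨$⟩ʳ_)
  π-injective = Injection.injective (↔⇒↣ π)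

  at : ∀ t u → π ⟨$⟩ʳ 0F ≡ u → π ⟨$⟩ʳ t ≡ swapIf (Inverse.to 2↔Bool u) 0F 1F t
  at 0F 0F π₀ = π₀
  at 0F 1F π₀ = π₀
  at 1F 0F π₀ with π ⟨$⟩ʳ 1F in π₁
  ... | 0F = contradiction (π-injective (trans π₁ (sym π₀))) λ ()
  ... | 1F = refl
  at 1F 1F π₀ with π ⟨$⟩ʳ 1F in π₁
  ... | 0F = refl
  ... | 1F = contradiction (π-injective (trans π₁ (sym π₀))) λ ()

swapPerm : Bool → Permutation′ 2
swapPerm false = Perm.id
swapPerm true  = Perm.transpose 0F 1F

isSwap-swapPerm : ∀ c → isSwap (swapPerm c) ≡ c
isSwap-swapPerm false = refl
isSwap-swapPerm true  = refl

swapPattern : (Fin (suc m) → Permutation′ 2) → Vec Bool m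
swapPattern σ = tabulate (isSwap ∘ σ ∘ suc)

swapPerms : Vec Bool m → Fin (suc m) → Permutation′ 2
swapPerms S j = swapPerm (lookup (false ∷ S) j)

swapPattern-swapPerms : (S : Vec Bool m) → swapPattern (swapPerms S) ≡ S
swapPattern-swapPerms S = trans (tabulate-cong (isSwap-swapPerm ∘ lookup S)) (tabulate∘lookup S)

coordPerm≡swapColumns : (σ : Fin (suc m) → Permutation′ 2) (j : Fin (suc m)) (t : Fin 2) →
  coordPerm σ j t ≡ swapColumns 0F 1F (swapPattern σ) j t
coordPerm≡swapColumns σ zero    t = refl
coordPerm≡swapColumns σ (suc j) t = trans (permutation₂ (σ (suc j)) t)
  (cong (λ c → swapIf c 0F 1F t) (sym (lookup∘tabulate (isSwap ∘ σ ∘ suc) j)))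

newVec≡exchange : (A : Assignment n (suc m)) {ι : Fin 2 → Fin n} → Injective _≡_ _≡_ ι →
  ∀ σ t → newVec A ι σ t ≡ vec (exchange A (ι 0F) (ι 1F) (swapPattern σ)) (ι t)
newVec≡exchange A {ι} ι-injective σ t = tabulate-cong λ j → cong (λ y → lookup (vec A y) j) (begin
  ι (coordPerm σ j t)                                ≡⟨ cong ι (coordPerm≡swapColumns σ j t) ⟩
  ι (swapColumns 0F 1F (swapPattern σ) j t)          ≡⟨ swapIf-map ι-injective (lookup (false ∷ S) j) 0F 1F t ⟩
  swapColumns (ι 0F) (ι 1F) (swapPattern σ) j (ι t)  ∎)
  where
  open ≡-Reasoning
  S = swapPattern σ

WMember : Assignment n s → (Fin k → Fin n) → (Fin s → Permutation′ k) → X n s → Set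
WMember A ι σ x = (∃ λ i → ((∀ t → ι t ≢ i) × vec A i ≡ x)) ⊎ (∃ λ t → newVec A ι σ t ≡ x)

module _ (A : Assignment n (suc m)) {ι : Fin 2 → Fin n} (ι-injective : Injective _≡_ _≡_ ι)
         (σ : Fin (suc m) → Permutation′ 2) where

  private
    E : Assignment n (suc m)
    E = exchange A (ι 0F) (ι 1F) (swapPattern σ)

  WMember⇒∈exchange : ∀ x → WMember A ι σ x → x ∈A E
  WMember⇒∈exchange x (inj₁ (i , i∉ι , Ai≡x)) =
    i , trans (exchange-other A (swapPattern σ) (i∉ι 0F ∘ sym) (i∉ι 1F ∘ sym)) Ai≡x
  WMember⇒∈exchange x (inj₂ (t , new≡x)) = ι t , trans (sym (newVec≡exchange A ι-injective σ t)) new≡x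

  ∈exchange⇒WMember : ∀ x → x ∈A E → WMember A ι σ x
  ∈exchange⇒WMember x (y , Ey≡x) with ι 0F ≟ y | ι 1F ≟ y
  ... | yes refl | _        = inj₂ (0F , trans (newVec≡exchange A ι-injective σ 0F) Ey≡x)
  ... | no _     | yes refl = inj₂ (1F , trans (newVec≡exchange A ι-injective σ 1F) Ey≡x)
  ... | no ι₀≢y  | no ι₁≢y  = inj₁ (y , (λ { 0F → ι₀≢y ; 1F → ι₁≢y }) ,
    trans (sym (exchange-other A (swapPattern σ) (ι₀≢y ∘ sym) (ι₁≢y ∘ sym))) Ey≡x)

InW⇒≈exchange : (A : Assignment n (suc m)) {ι : Fin 2 → Fin n} (ι-injective : Injective _≡_ _≡_ ι) →
  {B : Assignment n (suc m)} ((σ , _) : InW A ι B) → B ≈A exchange A (ι 0F) (ι 1F) (swapPattern σ)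
InW⇒≈exchange A ι-injective (σ , B≡W) x =
    WMember⇒∈exchange A ι-injective σ x ∘ proj₁ (B≡W x)
  , proj₂ (B≡W x) ∘ ∈exchange⇒WMember A ι-injective σ x

≈exchange⇒InW : (A : Assignment n (suc m)) {ι : Fin 2 → Fin n} (ι-injective : Injective _≡_ _≡_ ι) →
  ∀ σ {B : Assignment n (suc m)} → B ≈A exchange A (ι 0F) (ι 1F) (swapPattern σ) → InW A ι B
≈exchange⇒InW A ι-injective σ B≈E = σ , λ x →
    ∈exchange⇒WMember A ι-injective σ x ∘ proj₁ (B≈E x)
  , proj₂ (B≈E x) ∘ WMember⇒∈exchange A ι-injective σ x

pairIndex : Fin n → Fin n → Fin 2 → Fin n
pairIndex a b 0F = a
pairIndex a b 1F = b

pairIndex-injective : {a b : Fin n} → a ≢ b → Injective _≡_ _≡_ (pairIndex a b)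
pairIndex-injective a≢b {0F} {0F} _   = refl
pairIndex-injective a≢b {0F} {1F} a≡b = contradiction a≡b a≢b
pairIndex-injective a≢b {1F} {0F} b≡a = contradiction (sym b≡a) a≢b
pairIndex-injective a≢b {1F} {1F} _   = refl

exchange∈2opt : (A : Assignment n (suc m)) {a b : Fin n} → a ≢ b → ∀ S {B : Assignment n (suc m)} →
  B ≈A exchange A a b S → InKOpt 2 A B
exchange∈2opt A {a} {b} a≢b S {B} B≈E =
  pairIndex a b , ι-injective , ≈exchange⇒InW A {pairIndex a b} ι-injective (swapPerms S) {B}
    (subst (λ S′ → B ≈A exchange A a b S′) (sym (swapPattern-swapPerms S)) B≈E)
  where
  ι-injective : Injective _≡_ _≡_ (pairIndex a b)
  ι-injective = pairIndex-injective a≢b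

neighbour : Assignment n (suc m) → Code n m → Assignment n (suc m)
neighbour A (inj₁ tt)      = A
neighbour A (inj₂ (p , e)) = exchange A (lo p) (hi p) (bits e)

module _ (A : Assignment n (suc m)) where

  neighbour∈2opt : {a b : Fin n} → a ≢ b → ∀ c → InKOpt 2 A (neighbour A c)
  neighbour∈2opt {a} {b} a≢b (inj₁ tt) =
    exchange∈2opt A a≢b zeros {A} (≗⇒≈A {B = A} {exchange A a b zeros} (sym ∘ exchange-zero A a b))
    where zeros = replicate m false
  neighbour∈2opt a≢b (inj₂ (p , e)) = exchange∈2opt A (lo≢hi p) (bits e) {E} (≈A-refl {B = E})
    where E = exchange A (lo p) (hi p) (bits e)

  exchange≈neighbour : {a b : Fin n} → a ≢ b → ∀ S → ∃ λ c → exchange A a b S ≈A neighbour A c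
  exchange≈neighbour {a} {b} a≢b S with zero-or-nonzero S | toPair a b a≢b
  ... | inj₁ refl       | _                      =
    inj₁ tt , ≗⇒≈A {B = exchange A a b (replicate m false)} {A} (exchange-zero A a b)
  ... | inj₂ (e , refl) | p , inj₁ (refl , refl) =
    inj₂ (p , e) , ≈A-refl {B = exchange A (lo p) (hi p) (bits e)}
  ... | inj₂ (e , refl) | p , inj₂ (refl , refl) =
    inj₂ (p , e) , ≗⇒≈A {B = exchange A (hi p) (lo p) (bits e)} {exchange A (lo p) (hi p) (bits e)}
                       (exchange-comm A (hi p) (lo p) (bits e))

  2opt⇒neighbour : {B : Assignment n (suc m)} → InKOpt 2 A B → ∃ λ c → B ≈A neighbour A c
  2opt⇒neighbour {B} (ι , ι-injective , w@(σ , _)) with exchange≈neighbour ι₀≢ι₁ (swapPattern σ)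
    where
    ι₀≢ι₁ : ι 0F ≢ ι 1F
    ι₀≢ι₁ ι₀≡ι₁ = contradiction (ι-injective ι₀≡ι₁) λ ()
  ... | c , E≈N = c , ≈A-trans {B = B} {exchange A (ι 0F) (ι 1F) (swapPattern σ)} {neighbour A c}
                        (InW⇒≈exchange A {ι} ι-injective {B} w) E≈N

  neighbour-column₀ : ∀ c y → lookup (vec (neighbour A c) y) 0F ≡ lookup (vec A y) 0F
  neighbour-column₀ (inj₁ tt)      y = refl
  neighbour-column₀ (inj₂ (p , e)) y = refl

  neighbour-≈⇒≗ : ∀ c d → neighbour A c ≈A neighbour A d →
    ∀ y → vec (neighbour A c) y ≡ vec (neighbour A d) y
  neighbour-≈⇒≗ c d = ≈A⇒≗ {B = neighbour A c} {neighbour A d} 0F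
    (λ y → trans (neighbour-column₀ c y) (sym (neighbour-column₀ d y)))

  neighbour-injective : ∀ c d → neighbour A c ≈A neighbour A d → c ≡ d
  neighbour-injective c d N≈N with c | d | neighbour-≈⇒≗ c d N≈N
  ... | inj₁ tt      | inj₁ tt       | _    = refl
  ... | inj₁ tt      | inj₂ (q , e)  | rows =
    contradiction (sym (rows (lo q))) (exchange-movesˡ A (lo≢hi q) e)
  ... | inj₂ (p , e) | inj₁ tt       | rows = contradiction (rows (lo p)) (exchange-movesˡ A (lo≢hi p) e)
  ... | inj₂ (p , e) | inj₂ (q , e′) | rows = cong inj₂ (exchange-injective A p q e e′ rows)

mainTheorem3 : (n s : ℕ) → 2 ≤ s → 2 ≤ n → (A : Assignment n s) →
    HasSize (InKOpt 2 A) (1 + (n C 2) * (2 ^ (s ∸ 1) ∸ 1))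
mainTheorem3 (suc (suc n)) (suc m) _ (s≤s (s≤s z≤n)) A =
  HasSize-↔ (Code↔ (suc (suc n)) m) (neighbour A)
    (neighbour∈2opt A {0F} {1F} λ ()) (neighbour-injective A) (λ B → 2opt⇒neighbour A {B})
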